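{- Let $T$ be a functor from $\mathsf{Fin}^I$ to $\mathsf{Fin}$ and, for each $i\in I$, let $U_i$ be a functor from $\mathsf{Fin}^{K_i}$ to $\mathsf{Fin}$. If $T$ and all the $U_i$ are directly continuous (respectively, all exactly continuous), then the composite $T\circ(U_i)_{i\in I}$, which maps a family $(\mathcal A_{(i,k)})_{(i,k)\in\sum_i K_i}$ to $T\big((U_i(\mathcal A_{(i,k)})_{k\in K_i})_{i\in I}\big)$, is a directly continuous (respectively, exactly continuous) functor from $\mathsf{Fin}^{\sum_{i\in I}K_i}$ to $\mathsf{Fin}$.
   Context: Finiteness spaces $\mathcal A=(|\mathcal A|,\mathfrak F(\mathcal A))$: a set with $\mathfrak F(\mathcal A)\subseteq\mathcal P(|\mathcal A|)$ equal to its bidual, where $\mathfrak A^\perp=\{a': a\cap a'\text{ finite }\forall a\in\mathfrak A\}$. $\mathsf{Fin}$ is the category of finiteness spaces and finitary relations ($f\subseteq|\mathcal A|\times|\mathcal B|$ with $f[a]\in\mathfrak F(\mathcal B)$ for $a\in\mathfrak F(\mathcal A)$ and $f^\dagger[b']\in\mathfrak F(\mathcal A)^\perp$ for $b'\in\mathfrak F(\mathcal B)^\perp$, where $f^\dagger$ is the reverse relation). A functor from $\mathsf{Fin}^I$ to $\mathsf{Fin}$ is given by a functor on families of sets and relations (with images of relations independent of chosen sources/targets, preserving componentwise identities and composition) together with finiteness structures on the images of webs, such that images of families of finitary relations are finitary. Finiteness inclusion: $\mathcal A\sqsubseteq\mathcal B$ iff $|\mathcal A|\subseteq|\mathcal B|$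 and $\mathfrak F(\mathcal A)\subseteq\mathfrak F(\mathcal B)$; the supremum $\bigsqcup_j\mathcal A_j$ has web $\bigcup_j|\mathcal A_j|$ and structure $(\bigcup_j\mathfrak F(\mathcal A_j))^{\perp\perp}$, and is exact if $\bigcup_j\mathfrak F(\mathcal A_j)$ is already a finiteness structure. For $T:\mathsf{Fin}^I\to\mathsf{Fin}$, $\sqsubseteq$-monotonic componentwise: given, for each $i\in I$, a $\sqsubseteq$-directed family $(\mathcal A_{i,j})_{j\in J_i}$ (a componentwise directed family), and for $\vec j\in\prod_i J_i$ writing $\vec{\mathcal A}_{\vec j}=(\mathcal A_{i,j_i})_{i\in I}$, we say $T$ commutes to the componentwise supremum if $T\big((\bigsqcup_{j\in J_i}\mathcal A_{i,j})_{i\in I}\big)=\bigsqcup_{\vec j\in\prod_i J_i}T\vec{\mathcal A}_{\vec j}$. $T$ is directly continuous if it is $\sqsubseteq$-monotonic and commutes to all componentwise directed suprema; $T$ is exactly continuous if it is $\sqsubseteq$-monotonic and, whenever the family is componentwise directed and each $\bigsqcup_{j\in J_i}\mathcal A_{i,j}$ is exact, the supremum $\bigsqcup_{\vec j}T\vec{\mathcal A}_{\vec j}$ is exact and $T$ commutes to the componentwise supremum. -}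

module Defs where

open import Level using (0ℓ)
open import Data.Product using (Σ; ∃; _×_; _,_; proj₁; proj₂)
open import Data.List using (List)
open import Data.List.Membership.Propositional using (_∈_)
open import Relation.Unary using (Pred; _⊆_; _≐_; _∩_)
open import Relation.Binary.PropositionalEquality using (_≡_)

-- Sets are modelled as subsets (predicates) of an ambient type V of
-- "all elements"; relations are binary predicates on V.

Subset : Set → Set₁
Subset V = Pred V 0ℓ

Structure : Set → Set₂
Structure V = Pred (Subset V) (Level.suc 0ℓ)

Rel : Set → Set₁
Rel V = V → V → Set

Finite : {V : Set} → Subset V → Set
Finite {V} a = Σ (List V) λ l → ∀ x → a x → x ∈ l

Orth : {V : Set} → Subset V → Structure V → Structure V
Orth W 𝔉 a' = (a' ⊆ W) × (∀ a → 𝔉 a → Finite (a ∩ a'))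

record Space (V : Set) : Set₂ where
  field
    web : Subset V
    fin : Structure V
open Space public

IsFinSpace : {V : Set} → Space V → Set₁
IsFinSpace A =
  (∀ a → fin A a → a ⊆ web A) ×
  ((∀ a → fin A a → Orth (web A) (Orth (web A) (fin A)) a) ×
   (∀ a → Orth (web A) (Orth (web A) (fin A)) a → fin A a))

_≋_ : {V : Set} → Space V → Space V → Set₁
A ≋ B = (web A ≐ web B) × (fin A ≐ fin B)

_⊑_ : {V : Set} → Space V → Space V → Set₁
A ⊑ B = (web A ⊆ web B) × (fin A ⊆ fin B)

img : {V : Set} → Rel V → Subset V → Subset V
img f a y = ∃ λ x → a x × f x y

rev : {V : Set} → Rel V → Rel V
rev f x y = f y x

_∘R_ : {V : Set} → Rel V → Rel V → Rel V
(g ∘R f) x z = ∃ λ y → f x y × g y z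

idR : {V : Set} → Subset V → Rel V
idR W x y = W x × x ≡ y

_≐R_ : {V : Set} → Rel V → Rel V → Set
f ≐R g = ∀ x y → (f x y → g x y) × (g x y → f x y)

Typed : {V : Set} → Rel V → Subset V → Subset V → Set
Typed f A B = ∀ x y → f x y → A x × B y

Finitary : {V : Set} → Space V → Space V → Rel V → Set₁
Finitary A B f =
  Typed f (web A) (web B) ×
  ((∀ a → fin A a → fin B (img f a)) ×
   (∀ b' → Orth (web B) (fin B) b' → Orth (web A) (fin A) (img (rev f) b')))

-- The action on relations does not take sources/targets as arguments,
-- so images of relations are independent of the chosen sources/targets.

record PreFunctor (V : Set) (I : Set) : Set₂ where
  field
    obj : (I → Subset V) → Subset V
    rel : (I → Rel V) → Rel V
    str : (I → Space V) → Structure V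
open PreFunctor public

img₀ : {V I : Set} → PreFunctor V I → (I → Space V) → Space V
img₀ T A = record { web = obj T (λ i → web (A i)) ; fin = str T A }

record IsFunctor {V I : Set} (T : PreFunctor V I) : Set₂ where
  field
    obj-ext  : ∀ (A B : I → Subset V) → (∀ i → A i ≐ B i) → obj T A ≐ obj T B
    rel-ext  : ∀ (f g : I → Rel V) → (∀ i → f i ≐R g i) → rel T f ≐R rel T g
    rel-typed : ∀ (A B : I → Subset V) (f : I → Rel V) →
                (∀ i → Typed (f i) (A i) (B i)) → Typed (rel T f) (obj T A) (obj T B)
    rel-id   : ∀ (A : I → Subset V) → rel T (λ i → idR (A i)) ≐R idR (obj T A)
    rel-comp : ∀ (A B C : I → Subset V) (f g : I → Rel V) →
               (∀ i → Typed (f i) (A i) (B i)) → (∀ i → Typed (g i) (B i) (C i)) →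
               rel T (λ i → g i ∘R f i) ≐R (rel T g ∘R rel T f)
    str-ext  : ∀ (A B : I → Space V) → (∀ i → IsFinSpace (A i)) → (∀ i → IsFinSpace (B i)) →
               (∀ i → A i ≋ B i) → str T A ≐ str T B
    str-fin  : ∀ (A : I → Space V) → (∀ i → IsFinSpace (A i)) → IsFinSpace (img₀ T A)
    finitary : ∀ (A B : I → Space V) (f : I → Rel V) →
               (∀ i → IsFinSpace (A i)) → (∀ i → IsFinSpace (B i)) →
               (∀ i → Finitary (A i) (B i) (f i)) → Finitary (img₀ T A) (img₀ T B) (rel T f)

⋃web : {V J : Set} → (J → Space V) → Subset V
⋃web A x = ∃ λ j → web (A j) x

⋃fin : {V J : Set} → (J → Space V) → Structure V
⋃fin A a = ∃ λ j → fin (A j) a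

Sup : {V J : Set} → (J → Space V) → Space V
Sup A = record { web = ⋃web A ; fin = Orth (⋃web A) (Orth (⋃web A) (⋃fin A)) }

Exact : {V J : Set} → (J → Space V) → Set₁
Exact A = IsFinSpace (record { web = ⋃web A ; fin = ⋃fin A })

Directed : {V J : Set} → (J → Space V) → Set₁
Directed {J = J} A = J × (∀ j j' → ∃ λ k → (A j ⊑ A k) × (A j' ⊑ A k))

CompDirected : {V I : Set} (J : I → Set) → ((i : I) → J i → Space V) → Set₁
CompDirected J A = (∀ i j → IsFinSpace (A i j)) × (∀ i → Directed (A i))

TFam : {V I : Set} → PreFunctor V I → (J : I → Set) → ((i : I) → J i → Space V) →
       ((i : I) → J i) → Space V
TFam T J A js = img₀ T (λ i → A i (js i))

Monotonic : {V I : Set} → PreFunctor V I → Set₂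
Monotonic {V} {I} T = ∀ (A B : I → Space V) →
  (∀ i → IsFinSpace (A i)) → (∀ i → IsFinSpace (B i)) →
  (∀ i → A i ⊑ B i) → img₀ T A ⊑ img₀ T B

CommutesSup : {V I : Set} → PreFunctor V I → (J : I → Set) → ((i : I) → J i → Space V) → Set₁
CommutesSup T J A = img₀ T (λ i → Sup (A i)) ≋ Sup (TFam T J A)

DirectlyContinuous : {V I : Set} → PreFunctor V I → Set₂
DirectlyContinuous {V} {I} T = Monotonic T ×
  (∀ (J : I → Set) (A : (i : I) → J i → Space V) → CompDirected J A → CommutesSup T J A)

ExactlyContinuous : {V I : Set} → PreFunctor V I → Set₂
ExactlyContinuous {V} {I} T = Monotonic T ×
  (∀ (J : I → Set) (A : (i : I) → J i → Space V) → CompDirected J A →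
     (∀ i → Exact (A i)) → Exact (TFam T J A) × CommutesSup T J A)

Compose : {V I : Set} {K : I → Set} → PreFunctor V I → ((i : I) → PreFunctor V (K i)) →
          PreFunctor V (Σ I K)
Compose T U = record
  { obj = λ A → obj T (λ i → obj (U i) (λ k → A (i , k)))
  ; rel = λ f → rel T (λ i → rel (U i) (λ k → f (i , k)))
  ; str = λ A → str T (λ i → img₀ (U i) (λ k → A (i , k)))
  }

module Submission where

-- The argument is the paper's: a componentwise directed family (A_{(i,k),j})
-- indexed by Σ_i K_i is first pushed through each U_i, giving for every i a
-- directed family B_i = (U_i (A_{(i,k), js k})_k)_{js ∈ ∏_k J_{(i,k)}}; continuity
-- of U_i turns the inner suprema into ⊔ B_i, and continuity of T then gives
-- T(⊔ B_i)_i = ⊔_{jss} T (B_{i,jss i})_i.  Finally the index set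
-- ∏_i ∏_k J_{(i,k)} is just a currying of ∏_{(i,k)} J_{(i,k)}, so the two
-- families of images are mutually cofinal and have the same supremum (and one
-- is exact iff the other is).

open import Level using (Level)
open import Defs
open import Data.Product using (Σ; _×_; _,_; proj₁; proj₂)
open import Relation.Unary using (_⊆_; _≐_; _∩_)
open import Relation.Unary.Properties using (≐-sym; ≐-trans)

module _ {V : Set} where

  Biorth : Subset V → Structure V → Structure V
  Biorth W F = Orth W (Orth W F)

  ∩-finite-comm : {a b : Subset V} → Finite (a ∩ b) → Finite (b ∩ a)
  ∩-finite-comm (l , a∩b⊆l) = l , λ x (bx , ax) → a∩b⊆l x (ax , bx)

  Orth-mono : {W W' : Subset V} {F F' : Structure V} →
              W ⊆ W' → (∀ a → F' a → F a) → ∀ a → Orth W F a → Orth W' F' a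
  Orth-mono W⊆W' F'⊆F a (a⊆W , a⊥F) = (λ ax → W⊆W' (a⊆W ax)) , λ b F'b → a⊥F b (F'⊆F b F'b)

  ⊆-Biorth : {W : Subset V} {F : Structure V} →
             (∀ a → F a → a ⊆ W) → ∀ a → F a → Biorth W F a
  ⊆-Biorth F⊆W a Fa = F⊆W a Fa , λ a' (_ , a'⊥F) → ∩-finite-comm (a'⊥F a Fa)

  Biorth-mono : {W W' : Subset V} {F F' : Structure V} →
                W ≐ W' → (∀ a → F a → F' a) → ∀ a → Biorth W F a → Biorth W' F' a
  Biorth-mono (W⊆W' , W'⊆W) F⊆F' = Orth-mono W⊆W' (Orth-mono W'⊆W F⊆F')

  -- A bidual is a finiteness structure: 𝔉^⊥⊥⊥⊥ = 𝔉^⊥⊥ (via 𝔉^⊥ ⊆ 𝔉^⊥⊥⊥).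
  Biorth-isFinSpace : (W : Subset V) (F : Structure V) →
                      IsFinSpace (record { web = W ; fin = Biorth W F })
  Biorth-isFinSpace W F =
    within-web , ⊆-Biorth within-web ,
    Orth-mono (λ x → x) (⊆-Biorth (λ _ → proj₁))
    where
      within-web : ∀ a → Biorth W F a → a ⊆ W
      within-web _ = proj₁

  Sup-isFinSpace : {J : Set} (A : J → Space V) → IsFinSpace (Sup A)
  Sup-isFinSpace A = Biorth-isFinSpace (⋃web A) (⋃fin A)

  ≋-trans : {A B C : Space V} → A ≋ B → B ≋ C → A ≋ C
  ≋-trans (eW , eF) (eW' , eF') = ≐-trans eW eW' , ≐-trans eF eF'

  IsFinSpace-resp : {A B : Space V} → A ≋ B → IsFinSpace A → IsFinSpace B
  IsFinSpace-resp A≋B@((A⊆B , _) , (FA⊆FB , FB⊆FA)) (F⊆W , F⊆OO , OO⊆F) =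
    (λ a Fa ax → A⊆B (F⊆W a (FB⊆FA Fa) ax)) ,
    (λ a Fa → Biorth-mono (proj₁ A≋B) (λ _ → FA⊆FB) a (F⊆OO a (FB⊆FA Fa))) ,
    (λ a OOa → FA⊆FB (OO⊆F a (Biorth-mono (≐-sym (proj₁ A≋B)) (λ _ → FB⊆FA) a OOa)))

  ⊑-refl : {A : Space V} → A ⊑ A
  ⊑-refl = (λ x → x) , (λ a → a)

  ⋃-cofinal : {J J' : Set} (A : J → Space V) (B : J' → Space V) →
              (f : J → J') → (∀ j → A j ⊑ B (f j)) →
              (g : J' → J) → (∀ j' → B j' ⊑ A (g j')) →
              (⋃web A ≐ ⋃web B) × (⋃fin A ≐ ⋃fin B)
  ⋃-cofinal A B f A⊑Bf g B⊑Ag =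
    ((λ (j , w) → f j , proj₁ (A⊑Bf j) w) , (λ (j' , w) → g j' , proj₁ (B⊑Ag j') w)) ,
    ((λ (j , a) → f j , proj₂ (A⊑Bf j) a) , (λ (j' , a) → g j' , proj₂ (B⊑Ag j') a))

  Sup-cofinal : {J J' : Set} (A : J → Space V) (B : J' → Space V) →
                (⋃web A ≐ ⋃web B) × (⋃fin A ≐ ⋃fin B) → Sup A ≋ Sup B
  Sup-cofinal A B (eW , eF) =
    eW , (λ {a} → Biorth-mono eW (λ _ → proj₁ eF) a) , (λ {a} → Biorth-mono (≐-sym eW) (λ _ → proj₂ eF) a)

  Exact-cofinal : {J J' : Set} (A : J → Space V) (B : J' → Space V) →
                  (⋃web A ≐ ⋃web B) × (⋃fin A ≐ ⋃fin B) → Exact A → Exact B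
  Exact-cofinal A B = IsFinSpace-resp

  ≐R-trans : {f g h : Rel V} → f ≐R g → g ≐R h → f ≐R h
  ≐R-trans f≐g g≐h x y =
    (λ p → proj₁ (g≐h x y) (proj₁ (f≐g x y) p)) , (λ p → proj₂ (f≐g x y) (proj₂ (g≐h x y) p))

img₀-cong : {V I : Set} (T : PreFunctor V I) → IsFunctor T → (A B : I → Space V) →
            (∀ i → IsFinSpace (A i)) → (∀ i → IsFinSpace (B i)) →
            (∀ i → A i ≋ B i) → img₀ T A ≋ img₀ T B
img₀-cong T FT A B finA finB A≋B =
  obj-ext _ _ (λ i → proj₁ (A≋B i)) , str-ext A B finA finB A≋B
  where open IsFunctor FT

-- The images of a componentwise directed family under a monotonic functor
-- form a directed family of finiteness spaces: a common upper bound of two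
-- index vectors is taken componentwise.
TFam-directed : {V I : Set} (U : PreFunctor V I) → IsFunctor U → Monotonic U →
                (J : I → Set) (A : (i : I) → J i → Space V) → CompDirected J A →
                (∀ js → IsFinSpace (TFam U J A js)) × Directed (TFam U J A)
TFam-directed {I = I} U FU monoU J A (finA , dirA) =
  (λ js → str-fin _ (λ i → finA i (js i))) ,
  (λ i → proj₁ (dirA i)) ,
  λ js js' → ub js js' ,
             monoU _ _ (λ i → finA i (js i)) (λ i → finA i (ub js js' i)) (λ i → proj₁ (bound js js' i)) ,
             monoU _ _ (λ i → finA i (js' i)) (λ i → finA i (ub js js' i)) (λ i → proj₂ (bound js js' i))
  where
    open IsFunctor FU
    ub : (js js' : (i : I) → J i) → (i : I) → J i
    ub js js' i = proj₁ (proj₂ (dirA i) (js i) (js' i))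
    bound : (js js' : (i : I) → J i) (i : I) →
            (A i (js i) ⊑ A i (ub js js' i)) × (A i (js' i) ⊑ A i (ub js js' i))
    bound js js' i = proj₂ (proj₂ (dirA i) (js i) (js' i))

module Composite {V I : Set} {K : I → Set} (T : PreFunctor V I) (U : (i : I) → PreFunctor V (K i))
                 (FT : IsFunctor T) (FU : ∀ i → IsFunctor (U i)) where
  open IsFunctor

  _⟨_⟩ : {ℓ : Level} {X : Σ I K → Set ℓ} → ((p : Σ I K) → X p) → (i : I) → (k : K i) → X (i , k)
  A ⟨ i ⟩ = λ k → A (i , k)

  inner-fin : (A : Σ I K → Space V) → (∀ p → IsFinSpace (A p)) →
              ∀ i → IsFinSpace (img₀ (U i) (A ⟨ i ⟩))
  inner-fin A finA i = str-fin (FU i) (A ⟨ i ⟩) (λ k → finA (i , k))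

  Compose-isFunctor : IsFunctor (Compose T U)
  obj-ext Compose-isFunctor A B A≐B =
    obj-ext FT _ _ (λ i → obj-ext (FU i) _ _ (λ k → A≐B (i , k)))
  rel-ext Compose-isFunctor f g f≐g =
    rel-ext FT _ _ (λ i → rel-ext (FU i) _ _ (λ k → f≐g (i , k)))
  rel-typed Compose-isFunctor A B f tf =
    rel-typed FT _ _ _ (λ i → rel-typed (FU i) _ _ _ (λ k → tf (i , k)))
  rel-id Compose-isFunctor A =
    ≐R-trans (rel-ext FT _ _ (λ i → rel-id (FU i) (A ⟨ i ⟩)))
             (rel-id FT (λ i → obj (U i) (A ⟨ i ⟩)))
  rel-comp Compose-isFunctor A B C f g tf tg =
    ≐R-trans (rel-ext FT _ _ (λ i → rel-comp (FU i) (A ⟨ i ⟩) (B ⟨ i ⟩) (C ⟨ i ⟩) (f ⟨ i ⟩) (g ⟨ i ⟩)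
                                               (λ k → tf (i , k)) (λ k → tg (i , k))))
             (rel-comp FT (λ i → obj (U i) (A ⟨ i ⟩)) (λ i → obj (U i) (B ⟨ i ⟩))
                          (λ i → obj (U i) (C ⟨ i ⟩))
                          (λ i → rel (U i) (f ⟨ i ⟩)) (λ i → rel (U i) (g ⟨ i ⟩))
                          (λ i → rel-typed (FU i) _ _ _ (λ k → tf (i , k)))
                          (λ i → rel-typed (FU i) _ _ _ (λ k → tg (i , k))))
  str-ext Compose-isFunctor A B finA finB A≋B =
    str-ext FT _ _ (inner-fin A finA) (inner-fin B finB)
      (λ i → img₀-cong (U i) (FU i) (A ⟨ i ⟩) (B ⟨ i ⟩)
                       (λ k → finA (i , k)) (λ k → finB (i , k)) (λ k → A≋B (i , k)))
  str-fin Compose-isFunctor A finA = str-fin FT _ (inner-fin A finA)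
  finitary Compose-isFunctor A B f finA finB ff =
    finitary FT _ _ _ (inner-fin A finA) (inner-fin B finB)
      (λ i → finitary (FU i) _ _ _ (λ k → finA (i , k)) (λ k → finB (i , k)) (λ k → ff (i , k)))

  Compose-monotonic : Monotonic T → (∀ i → Monotonic (U i)) → Monotonic (Compose T U)
  Compose-monotonic monoT monoU A B finA finB A⊑B =
    monoT _ _ (inner-fin A finA) (inner-fin B finB)
      (λ i → monoU i _ _ (λ k → finA (i , k)) (λ k → finB (i , k)) (λ k → A⊑B (i , k)))

  module Directed-family (monoU : ∀ i → Monotonic (U i))
                         (J : Σ I K → Set) (A : (p : Σ I K) → J p → Space V)
                         (cdA : CompDirected J A) where

    slice-directed : ∀ i → CompDirected (J ⟨ i ⟩) (A ⟨ i ⟩)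
    slice-directed i = (λ k → proj₁ cdA (i , k)) , (λ k → proj₂ cdA (i , k))

    J⁺ : I → Set
    J⁺ i = (k : K i) → J (i , k)

    B : (i : I) → J⁺ i → Space V
    B i = TFam (U i) (J ⟨ i ⟩) (A ⟨ i ⟩)

    B-directed : CompDirected J⁺ B
    B-directed =
      (λ i → proj₁ (TFam-directed (U i) (FU i) (monoU i) _ _ (slice-directed i))) ,
      (λ i → proj₂ (TFam-directed (U i) (FU i) (monoU i) _ _ (slice-directed i)))

    -- Indexing by ∏_i ∏_k J_{(i,k)} or by ∏_{(i,k)} J_{(i,k)} is the same up
    -- to currying, so both families of images have the same unions.
    curry-cofinal : (⋃web (TFam T J⁺ B) ≐ ⋃web (TFam (Compose T U) J A)) ×
                    (⋃fin (TFam T J⁺ B) ≐ ⋃fin (TFam (Compose T U) J A))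
    curry-cofinal =
      ⋃-cofinal _ _ (λ jss (i , k) → jss i k) (λ _ → ⊑-refl)
                    (λ js i k → js (i , k)) (λ _ → ⊑-refl)

    -- If each U_i and T commute to the relevant suprema, so does the composite:
    --   T (U_i (⊔ A_{(i,k)})_k)_i ≋ T (⊔ B_i)_i ≋ ⊔ T (B_i)_i ≋ ⊔ (T ∘ U) A.
    Compose-commutes : (∀ i → CommutesSup (U i) (J ⟨ i ⟩) (A ⟨ i ⟩)) → CommutesSup T J⁺ B →
                       CommutesSup (Compose T U) J A
    Compose-commutes commU commT =
      ≋-trans (img₀-cong T FT _ _ (inner-fin _ (λ p → Sup-isFinSpace (A p)))
                                  (λ i → Sup-isFinSpace (B i)) commU)
        (≋-trans commT (Sup-cofinal _ _ curry-cofinal))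

  Compose-directlyContinuous : DirectlyContinuous T → (∀ i → DirectlyContinuous (U i)) →
                               DirectlyContinuous (Compose T U)
  Compose-directlyContinuous (monoT , supT) dU =
    Compose-monotonic monoT monoU ,
    λ J A cdA → let open Directed-family monoU J A cdA in
      Compose-commutes (λ i → proj₂ (dU i) _ _ (slice-directed i)) (supT J⁺ B B-directed)
    where
      monoU : ∀ i → Monotonic (U i)
      monoU i = proj₁ (dU i)

  -- Exact continuity is preserved by composition: exactness of the inner
  -- suprema feeds the exact continuity of T, and transfers along currying.
  Compose-exactlyContinuous : ExactlyContinuous T → (∀ i → ExactlyContinuous (U i)) →
                              ExactlyContinuous (Compose T U)
  Compose-exactlyContinuous (monoT , supT) eU =
    Compose-monotonic monoT monoU ,
    λ J A cdA exactA →
      let open Directed-family monoU J A cdA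
          supU = λ i → proj₂ (eU i) _ _ (slice-directed i) (λ k → exactA (i , k))
          (exactTB , commT) = supT J⁺ B B-directed (λ i → proj₁ (supU i))
      in Exact-cofinal _ _ curry-cofinal exactTB ,
         Compose-commutes (λ i → proj₂ (supU i)) commT
    where
      monoU : ∀ i → Monotonic (U i)
      monoU i = proj₁ (eU i)

lemma9 : {V I : Set} {K : I → Set} (T : PreFunctor V I) (U : (i : I) → PreFunctor V (K i)) →
         IsFunctor T → (∀ i → IsFunctor (U i)) →
         ((DirectlyContinuous T × (∀ i → DirectlyContinuous (U i))) →
           IsFunctor (Compose T U) × DirectlyContinuous (Compose T U)) ×
         ((ExactlyContinuous T × (∀ i → ExactlyContinuous (U i))) →
           IsFunctor (Compose T U) × ExactlyContinuous (Compose T U))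
lemma9 T U FT FU =
  (λ (dT , dU) → Compose-isFunctor , Compose-directlyContinuous dT dU) ,
  (λ (eT , eU) → Compose-isFunctor , Compose-exactlyContinuous eT eU)
  where open Composite T U FT FU
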